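{- Let $\lambda$ be a real number and let $D$ be an edge-minimal $\lambda$-counterexample. Let $S$ be any subset of the vertices of $D$ such that $N_1^+(S)$ is non-empty. Then $d_2^+(S) < \lambda\, d_1^+(S)$.
   Context: All digraphs are finite oriented simple graphs (no loops, no multiple edges, no directed 2-cycles). For vertices $u,v$, $d(u,v)$ is the length of a shortest directed path from $u$ to $v$; for $u=v$, $d(v,v)$ is the length of a shortest directed cycle through $v$ (not $0$). For a vertex $v$, $N_k^+(v)=\{u: d(v,u)=k\}$ and $d_k^+(v)=|N_k^+(v)|$. For a set $S$ of vertices, $N_k^+(S)=\{u : \min_{s\in S} d(s,u)=k\}$ and $d_k^+(S)=|N_k^+(S)|$ (so $S$ may intersect $N_k^+(S)$). A digraph $D$ is a $\lambda$-counterexample if $d_2^+(v)<\lambda d_1^+(v)$ for every vertex $v$ of $D$. $D$ is an edge-minimal $\lambda$-counterexample if it is a $\lambda$-counterexample and deleting any non-empty set of edges of $D$ does not yield a $\lambda$-counterexample. -}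

module Defs where

open import Data.Bool using (Bool; true; false; _∧_; not; if_then_else_)
open import Data.Nat using (ℕ; zero; suc)
open import Data.Fin using (Fin; _≟_; toℕ)
open import Data.Fin.Subset using (Subset; ∣_∣; _∈_; ⁅_⁆)
open import Data.Vec using (tabulate; lookup)
open import Data.List using (List; allFin; upTo)
open import Data.Bool.ListAction using (any)
open import Data.Product using (Σ; ∃; _×_)
open import Data.Sum using (_⊎_)
open import Data.Empty using (⊥)
open import Relation.Nullary using (¬_; does)
open import Relation.Binary.PropositionalEquality using (_≡_)
open import Function.Bundles using (_⇔_)
open import Data.Integer using (+_)
open import Data.Rational using (ℚ; _<_; _*_; _/_)

record ℝ : Set₁ where
  field
    L U        : ℚ → Set
    inhabitedL : ∃ L
    inhabitedU : ∃ U
    roundedL   : ∀ q → L q ⇔ (∃ λ r → (q < r) × L r)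
    roundedU   : ∀ r → U r ⇔ (∃ λ q → (q < r) × U q)
    disjoint   : ∀ q → ¬ (L q × U q)
    located    : ∀ q r → q < r → L q ⊎ U r

ℕ→ℚ : ℕ → ℚ
ℕ→ℚ n = (+ n) / 1

-- a <ℝ x · b  means  a < x * b  for naturals a, b and a real x:
-- there is a rational q < x (q in the lower cut) with a < q * b.
_<ℝ_·_ : ℕ → ℝ → ℕ → Set
a <ℝ x · b = ∃ λ q → ℝ.L x q × (ℕ→ℚ a < q * ℕ→ℚ b)

Adj : ℕ → Set
Adj n = Fin n → Fin n → Bool

record Oriented {n : ℕ} (A : Adj n) : Set where
  field
    loopless : ∀ v → A v v ≡ false
    noTwoCyc : ∀ u v → A u v ≡ true → A v u ≡ false

walk : ∀ {n} → Adj n → ℕ → Fin n → Fin n → Bool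
walk {n} A zero    u v = does (u ≟ v)
walk {n} A (suc k) u v = any (λ w → walk A k u w ∧ A w v) (allFin n)

walkFrom : ∀ {n} → Adj n → Subset n → ℕ → Fin n → Bool
walkFrom {n} A S k v = any (λ s → lookup S s ∧ walk A k s v) (allFin n)

-- min_{s ∈ S} d(s,v) = k  (k ≥ 1; distances are lengths of shortest
-- walks of positive length, so d(v,v) is the shortest cycle through v)
atDist : ∀ {n} → Adj n → Subset n → ℕ → Fin n → Bool
atDist A S k v =
  walkFrom A S k v ∧ not (any (λ j → walkFrom A S (suc j) v) (upTo (Data.Nat.pred k)))
  where import Data.Nat

N⁺ : ∀ {n} → Adj n → ℕ → Subset n → Subset n
N⁺ A k S = tabulate (atDist A S k)

d⁺ : ∀ {n} → Adj n → ℕ → Subset n → ℕ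
d⁺ A k S = ∣ N⁺ A k S ∣

Counterexample : ∀ {n} → ℝ → Adj n → Set
Counterexample λ' A = ∀ v → d⁺ A 2 ⁅ v ⁆ <ℝ λ' · d⁺ A 1 ⁅ v ⁆

ProperSub : ∀ {n} → Adj n → Adj n → Set
ProperSub A' A =
  (∀ u v → A' u v ≡ true → A u v ≡ true) ×
  (∃ λ u → ∃ λ v → (A u v ≡ true) × (A' u v ≡ false))

EdgeMinimal : ∀ {n} → ℝ → Adj n → Set
EdgeMinimal λ' A =
  Counterexample λ' A × (∀ A' → ProperSub A' A → ¬ Counterexample λ' A')

module Submission where

-- For a vertex set Y write  out A Y  for its
-- out-neighbourhood and  beyond A Y = out A Y ∖ Y, so that N₁⁺(S) = out A S
-- and N₂⁺(S) = beyond A (out A S).  Call Y below ratio if Y is empty or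
-- |beyond A Y| < λ|Y|.  As out A S is the union of the rows A s (s ∈ S), it
-- suffices that being below ratio survives adding a row A x.  Three facts
-- give this union step: every row is below ratio (A is a counterexample);
-- a proper part T of a row A u has |beyond A T| ≥ λ|T| (otherwise replacing
-- the out-neighbourhood of u by T deletes edges and leaves a counterexample,
-- against minimality); and Y ↦ |beyond A Y| is submodular.  Applied to
-- A x, Z and A x ∩ Z they yield the bound for A x ∪ Z.

open import Defs
open import Algebra.Bundles using (CommutativeMonoid)
open import Data.Bool using (Bool; true; false; _∧_; _∨_; not; if_then_else_)
import Data.Bool as Bool
import Data.Bool.Properties as BoolP
open import Data.Bool.ListAction using (any; or)
open import Data.Empty using (⊥; ⊥-elim)
open import Data.Fin using (Fin; _≟_)
import Data.Fin as Fin
import Data.Fin.Properties as FinP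
open import Data.Fin.Subset using (Subset; Nonempty; ∣_∣; ⁅_⁆)
import Data.Fin.Subset.Properties as SubsetP
import Data.Integer as ℤ
import Data.Integer.Properties as ℤP
open import Data.List using (List; []; _∷_; allFin)
import Data.List.Properties as ListP
open import Data.List.Membership.Propositional using (lose)
open import Data.List.Membership.Propositional.Properties using (∈-allFin)
open import Data.List.Relation.Unary.Any using (satisfied)
open import Data.List.Relation.Unary.Any.Properties using (any⁺; any⁻)
open import Data.Nat using (ℕ; zero; suc; _+_; _≤_; z≤n)
import Data.Nat.Coprimality as Coprimality
import Data.Nat.Properties as ℕP
open import Data.Product using (∃; _×_; _,_; proj₁; proj₂)
open import Data.Rational using (mkℚ)
import Data.Rational as ℚ
import Data.Rational.Properties as ℚP
open import Data.Sum using (_⊎_; inj₁; inj₂)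
open import Data.Vec using (tabulate; lookup)
import Data.Vec.Properties as VecP
open import Function.Bundles using (Equivalence; _⇔_; mk⇔)
open import Relation.Nullary using (¬_; Dec; yes; no; does)
open import Relation.Binary.PropositionalEquality
open import Algebra.Properties.CommutativeSemigroup ℕP.+-commutativeSemigroup
  using () renaming (interchange to +-interchange)
open import Algebra.Properties.CommutativeSemigroup
  (CommutativeMonoid.commutativeSemigroup BoolP.∨-commutativeMonoid)
  using () renaming (interchange to ∨-interchange)

ℕ→ℚ-canonical : ∀ a → ℕ→ℚ a ≡ mkℚ (ℤ.+ a) 0 (Coprimality.sym (Coprimality.1-coprimeTo a))
ℕ→ℚ-canonical a = ℚP.normalize-coprime (Coprimality.sym (Coprimality.1-coprimeTo a))

ℕ→ℚ-+ : ∀ a b → ℕ→ℚ (a + b) ≡ ℕ→ℚ a ℚ.+ ℕ→ℚ b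
ℕ→ℚ-+ a b = begin
  (ℤ.+ (a + b)) ℚ./ 1                                       ≡⟨ cong (ℚ._/ 1) (ℤP.pos-+ a b) ⟩
  ((ℤ.+ a) ℤ.+ (ℤ.+ b)) ℚ./ 1                               ≡⟨ cong₂ (λ i j → (i ℤ.+ j) ℚ./ 1) (sym (ℤP.*-identityʳ (ℤ.+ a))) (sym (ℤP.*-identityʳ (ℤ.+ b))) ⟩
  ((ℤ.+ a) ℤ.* (ℤ.+ 1) ℤ.+ (ℤ.+ b) ℤ.* (ℤ.+ 1)) ℚ./ 1      ≡⟨ sym (cong₂ ℚ._+_ (ℕ→ℚ-canonical a) (ℕ→ℚ-canonical b)) ⟩
  ℕ→ℚ a ℚ.+ ℕ→ℚ b                                           ∎
  where
  open ≡-Reasoning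

ℕ→ℚ-mono : ∀ {a b} → a ≤ b → ℕ→ℚ a ℚ.≤ ℕ→ℚ b
ℕ→ℚ-mono {a} {b} a≤b =
  subst₂ ℚ._≤_ (sym (ℕ→ℚ-canonical a)) (sym (ℕ→ℚ-canonical b))
    (ℚ.*≤* (subst₂ ℤ._≤_ (sym (ℤP.*-identityʳ (ℤ.+ a))) (sym (ℤP.*-identityʳ (ℤ.+ b))) (ℤ.+≤+ a≤b)))

*ℕ-mono : ∀ {p q} c → p ℚ.≤ q → p ℚ.* ℕ→ℚ c ℚ.≤ q ℚ.* ℕ→ℚ c
*ℕ-mono c = ℚP.*-monoʳ-≤-nonNeg (ℕ→ℚ c) {{ℚP.normalize-nonNeg c 1}}

+-cancelʳ-< : ∀ r p q → p ℚ.+ r ℚ.< q ℚ.+ r → p ℚ.< q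
+-cancelʳ-< r p q p+r<q+r =
  ℚP.≰⇒> (λ q≤p → ℚP.<-irrefl refl (ℚP.<-≤-trans p+r<q+r (ℚP.+-monoˡ-≤ r q≤p)))

ratio-exchange : ∀ q (a b c d a₁ b₁ a₂ b₂ : ℕ) → a + c ≤ a₁ + a₂ → b + d ≡ b₁ + b₂ →
  ℕ→ℚ a₁ ℚ.< q ℚ.* ℕ→ℚ b₁ → ℕ→ℚ a₂ ℚ.< q ℚ.* ℕ→ℚ b₂ → q ℚ.* ℕ→ℚ d ℚ.≤ ℕ→ℚ c →
  ℕ→ℚ a ℚ.< q ℚ.* ℕ→ℚ b
ratio-exchange q a b c d a₁ b₁ a₂ b₂ sum≤ sum≡ h₁ h₂ hc =
  +-cancelʳ-< (ℕ→ℚ c) (ℕ→ℚ a) (q ℚ.* ℕ→ℚ b) (begin-strict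
    ℕ→ℚ a ℚ.+ ℕ→ℚ c                  ≡⟨ sym (ℕ→ℚ-+ a c) ⟩
    ℕ→ℚ (a + c)                      ≤⟨ ℕ→ℚ-mono sum≤ ⟩
    ℕ→ℚ (a₁ + a₂)                    ≡⟨ ℕ→ℚ-+ a₁ a₂ ⟩
    ℕ→ℚ a₁ ℚ.+ ℕ→ℚ a₂                <⟨ ℚP.+-mono-< h₁ h₂ ⟩
    q ℚ.* ℕ→ℚ b₁ ℚ.+ q ℚ.* ℕ→ℚ b₂    ≡⟨ sym (scaled-sum b₁ b₂) ⟩
    q ℚ.* ℕ→ℚ (b₁ + b₂)              ≡⟨ cong (λ m → q ℚ.* ℕ→ℚ m) (sym sum≡) ⟩
    q ℚ.* ℕ→ℚ (b + d)                ≡⟨ scaled-sum b d ⟩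
    q ℚ.* ℕ→ℚ b ℚ.+ q ℚ.* ℕ→ℚ d      ≤⟨ ℚP.+-monoʳ-≤ (q ℚ.* ℕ→ℚ b) hc ⟩
    q ℚ.* ℕ→ℚ b ℚ.+ ℕ→ℚ c            ∎)
  where
  open ℚP.≤-Reasoning
  scaled-sum : ∀ m k → q ℚ.* ℕ→ℚ (m + k) ≡ q ℚ.* ℕ→ℚ m ℚ.+ q ℚ.* ℕ→ℚ k
  scaled-sum m k = trans (cong (q ℚ.*_) (ℕ→ℚ-+ m k)) (ℚP.*-distribˡ-+ q (ℕ→ℚ m) (ℕ→ℚ k))

<ℝ-antitoneˡ : (x : ℝ) {a a′ b : ℕ} → a ≤ a′ → a′ <ℝ x · b → a <ℝ x · b
<ℝ-antitoneˡ x a≤a′ (q , Lq , a′<qb) = q , Lq , ℚP.≤-<-trans (ℕ→ℚ-mono a≤a′) a′<qb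

≮ℝ⇒≥ : (x : ℝ) {a b : ℕ} → ¬ (a <ℝ x · b) → ∀ {q} → ℝ.L x q → q ℚ.* ℕ→ℚ b ℚ.≤ ℕ→ℚ a
≮ℝ⇒≥ x a≮xb Lq = ℚP.≮⇒≥ (λ a<qb → a≮xb (_ , Lq , a<qb))

-- The exchange argument for a real ratio x: combine two strict bounds and one
-- failed bound, using the larger of the two lower-cut witnesses.
<ℝ-exchange : (x : ℝ) (a b c d a₁ b₁ a₂ b₂ : ℕ) → a + c ≤ a₁ + a₂ → b + d ≡ b₁ + b₂ →
  a₁ <ℝ x · b₁ → a₂ <ℝ x · b₂ → ¬ (c <ℝ x · d) → a <ℝ x · b
<ℝ-exchange x a b c d a₁ b₁ a₂ b₂ sum≤ sum≡ (q₁ , L₁ , h₁) (q₂ , L₂ , h₂) c≮xd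
  with ℚP.≤-total q₁ q₂
... | inj₁ q₁≤q₂ = q₂ , L₂ ,
  ratio-exchange q₂ a b c d a₁ b₁ a₂ b₂ sum≤ sum≡ (ℚP.<-≤-trans h₁ (*ℕ-mono b₁ q₁≤q₂)) h₂ (≮ℝ⇒≥ x {c} {d} c≮xd L₂)
... | inj₂ q₂≤q₁ = q₁ , L₁ ,
  ratio-exchange q₁ a b c d a₁ b₁ a₂ b₂ sum≤ sum≡ h₁ (ℚP.<-≤-trans h₂ (*ℕ-mono b₂ q₂≤q₁)) (≮ℝ⇒≥ x {c} {d} c≮xd L₁)

VSet : ℕ → Set
VSet n = Fin n → Bool

infixr 6 _∩_ _∖_
infixr 5 _∪_
infix 4 _⊆_ _≐_

_∪_ _∩_ _∖_ : ∀ {n} → VSet n → VSet n → VSet n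
(Y ∪ Z) v = Y v ∨ Z v
(Y ∩ Z) v = Y v ∧ Z v
(Y ∖ Z) v = Y v ∧ not (Z v)

_⊆_ _≐_ : ∀ {n} → VSet n → VSet n → Set
Y ⊆ Z = ∀ v → Y v ≡ true → Z v ≡ true
Y ≐ Z = ∀ v → Y v ≡ Z v

∧-true : ∀ {x y} → x ∧ y ≡ true ⇔ (x ≡ true × y ≡ true)
∧-true {x} {y} = mk⇔ (λ e → BoolP.∧-conicalˡ x y e , BoolP.∧-conicalʳ x y e) (λ { (refl , refl) → refl })

∨-true : ∀ {x y} → x ∨ y ≡ true ⇔ (x ≡ true ⊎ y ≡ true)
∨-true {true}  = mk⇔ inj₁ (λ _ → refl)
∨-true {false} = mk⇔ inj₂ (λ { (inj₁ ()) ; (inj₂ e) → e })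

any-true : ∀ {n} (p : Fin n → Bool) → any p (allFin n) ≡ true ⇔ (∃ λ i → p i ≡ true)
any-true {n} p = mk⇔
  (λ e → let i , pi = satisfied (any⁻ p (allFin n) (Equivalence.from BoolP.T-≡ e))
         in i , Equivalence.to BoolP.T-≡ pi)
  (λ { (i , pi) → Equivalence.to BoolP.T-≡ (any⁺ p (lose (∈-allFin i) (Equivalence.from BoolP.T-≡ pi))) })

bit : Bool → ℕ
bit true  = 1
bit false = 0

size : ∀ {n} → VSet n → ℕ
size {zero}  Y = 0
size {suc n} Y = bit (Y Fin.zero) + size (λ i → Y (Fin.suc i))

size-tabulate : ∀ {n} (Y : VSet n) → ∣ tabulate Y ∣ ≡ size Y
size-tabulate {zero}  Y = refl
size-tabulate {suc n} Y with Y Fin.zero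
... | true  = cong suc (size-tabulate (λ i → Y (Fin.suc i)))
... | false = size-tabulate (λ i → Y (Fin.suc i))

size-cong : ∀ {n} {Y Z : VSet n} → Y ≐ Z → size Y ≡ size Z
size-cong {zero}  Y≐Z = refl
size-cong {suc n} Y≐Z = cong₂ _+_ (cong bit (Y≐Z Fin.zero)) (size-cong (λ i → Y≐Z (Fin.suc i)))

size-mono : ∀ {n} {Y Z : VSet n} → Y ⊆ Z → size Y ≤ size Z
size-mono {zero}  Y⊆Z = z≤n
size-mono {suc n} {Y} {Z} Y⊆Z = ℕP.+-mono-≤ (bit-mono (Y⊆Z Fin.zero)) (size-mono (λ i → Y⊆Z (Fin.suc i)))
  where
  bit-mono : ∀ {x y} → (x ≡ true → y ≡ true) → bit x ≤ bit y
  bit-mono {false}         _   = z≤n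
  bit-mono {true}  {true}  _   = ℕP.≤-refl
  bit-mono {true}  {false} x⇒y with () ← x⇒y refl

size-additive : ∀ {n} {X Y Z : VSet n} → (∀ v → bit (X v) ≡ bit (Y v) + bit (Z v)) →
  size X ≡ size Y + size Z
size-additive {zero}  split = refl
size-additive {suc n} {X} {Y} {Z} split = begin
  bit (X Fin.zero) + size (X ∘suc)                                ≡⟨ cong₂ _+_ (split Fin.zero) (size-additive (λ i → split (Fin.suc i))) ⟩
  (bit (Y Fin.zero) + bit (Z Fin.zero)) + (size (Y ∘suc) + size (Z ∘suc)) ≡⟨ +-interchange (bit (Y Fin.zero)) (bit (Z Fin.zero)) _ _ ⟩
  (bit (Y Fin.zero) + size (Y ∘suc)) + (bit (Z Fin.zero) + size (Z ∘suc)) ∎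
  where
  open ≡-Reasoning
  _∘suc : VSet (suc n) → VSet n
  (W ∘suc) i = W (Fin.suc i)

size-split : ∀ {n} (Y Z : VSet n) → size Y ≡ size (Y ∩ Z) + size (Y ∖ Z)
size-split Y Z = size-additive (λ v → bit-split (Y v) (Z v))
  where
  bit-split : ∀ y z → bit y ≡ bit (y ∧ z) + bit (y ∧ not z)
  bit-split true  true  = refl
  bit-split true  false = refl
  bit-split false _     = refl

size-∪ : ∀ {n} (Y Z : VSet n) → size (Y ∪ Z) ≡ size Y + size (Z ∖ Y)
size-∪ Y Z = size-additive (λ v → bit-∪ (Y v) (Z v))
  where
  bit-∪ : ∀ y z → bit (y ∨ z) ≡ bit y + bit (z ∧ not y)
  bit-∪ true  true  = refl
  bit-∪ true  false = refl
  bit-∪ false true  = refl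
  bit-∪ false false = refl

size-∪-∩ : ∀ {n} (Y Z : VSet n) → size (Y ∪ Z) + size (Y ∩ Z) ≡ size Y + size Z
size-∪-∩ Y Z = begin
  size (Y ∪ Z) + size (Y ∩ Z)                 ≡⟨ cong (_+ size (Y ∩ Z)) (size-∪ Y Z) ⟩
  (size Y + size (Z ∖ Y)) + size (Y ∩ Z)      ≡⟨ rearrange (size Y) (size (Z ∖ Y)) (size (Y ∩ Z)) ⟩
  size Y + (size (Y ∩ Z) + size (Z ∖ Y))      ≡⟨ cong (λ m → size Y + (m + size (Z ∖ Y))) (size-cong (λ v → BoolP.∧-comm (Y v) (Z v))) ⟩
  size Y + (size (Z ∩ Y) + size (Z ∖ Y))      ≡⟨ cong (size Y +_) (sym (size-split Z Y)) ⟩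
  size Y + size Z                             ∎
  where
  open ≡-Reasoning
  rearrange : ∀ a b c → (a + b) + c ≡ a + (c + b)
  rearrange a b c = trans (ℕP.+-assoc a b c) (cong (a +_) (ℕP.+-comm b c))

-- The out-neighbourhood of a set Y: vertices with an in-neighbour in Y (it may
-- meet Y).  Note that  walk A (suc k) u  is definitionally  out A (walk A k u).
out : ∀ {n} → Adj n → VSet n → VSet n
out {n} A Y v = any (λ w → Y w ∧ A w v) (allFin n)

beyond : ∀ {n} → Adj n → VSet n → VSet n
beyond A Y = out A Y ∖ Y

_⊆ₑ_ : ∀ {n} → Adj n → Adj n → Set
A′ ⊆ₑ A = ∀ u v → A′ u v ≡ true → A u v ≡ true

out-true : ∀ {n} (A : Adj n) (Y : VSet n) v →
  out A Y v ≡ true ⇔ (∃ λ w → Y w ≡ true × A w v ≡ true)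
out-true A Y v = mk⇔
  (λ e → let w , e′ = Equivalence.to (any-true _) e in w , Equivalence.to ∧-true e′)
  (λ { (w , e) → Equivalence.from (any-true _) (w , Equivalence.from ∧-true e) })

out-mono : ∀ {n} {A′ A : Adj n} {Y Z : VSet n} → A′ ⊆ₑ A → Y ⊆ Z → out A′ Y ⊆ out A Z
out-mono {A′ = A′} {A} {Y} {Z} A′⊆A Y⊆Z v e =
  let w , Yw , A′wv = Equivalence.to (out-true A′ Y v) e
  in Equivalence.from (out-true A Z v) (w , Y⊆Z w Yw , A′⊆A w v A′wv)

out-cong : ∀ {n} (A : Adj n) {Y Z : VSet n} → Y ≐ Z → out A Y ≐ out A Z
out-cong {n} A Y≐Z v = cong or (ListP.map-cong (λ w → cong (_∧ A w v) (Y≐Z w)) (allFin n))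

beyond-cong : ∀ {n} (A : Adj n) {Y Z : VSet n} → Y ≐ Z → beyond A Y ≐ beyond A Z
beyond-cong A Y≐Z v = cong₂ (λ o y → o ∧ not y) (out-cong A Y≐Z v) (Y≐Z v)

out-∪ : ∀ {n} (A : Adj n) (Y Z : VSet n) → out A (Y ∪ Z) ≐ out A Y ∪ out A Z
out-∪ A Y Z v = BoolP.⇔→≡ (mk⇔ to from)
  where
  to : out A (Y ∪ Z) v ≡ true → (out A Y ∪ out A Z) v ≡ true
  to e with Equivalence.to (out-true A (Y ∪ Z) v) e
  ... | w , YZw , Awv with Equivalence.to ∨-true YZw
  ...   | inj₁ Yw = Equivalence.from ∨-true (inj₁ (Equivalence.from (out-true A Y v) (w , Yw , Awv)))
  ...   | inj₂ Zw = Equivalence.from (∨-true {out A Y v}) (inj₂ (Equivalence.from (out-true A Z v) (w , Zw , Awv)))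
  from : (out A Y ∪ out A Z) v ≡ true → out A (Y ∪ Z) v ≡ true
  from e with Equivalence.to (∨-true {out A Y v}) e
  ... | inj₁ oY = out-mono {A′ = A} {A} (λ _ _ e → e) (λ w Yw → Equivalence.from (∨-true {Y w}) (inj₁ Yw)) v oY
  ... | inj₂ oZ = out-mono {A′ = A} {A} (λ _ _ e → e) (λ w Zw → Equivalence.from (∨-true {Y w}) (inj₂ Zw)) v oZ

-- Y together with its out-neighbourhood; its size is |Y| + |beyond A Y|,
-- which turns statements about beyond into statements about closures.
closure : ∀ {n} → Adj n → VSet n → VSet n
closure A Y = Y ∪ out A Y

size-closure : ∀ {n} (A : Adj n) (Y : VSet n) → size (closure A Y) ≡ size Y + size (beyond A Y)
size-closure A Y = size-∪ Y (out A Y)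

closure-mono : ∀ {n} (A : Adj n) {Y Z : VSet n} → Y ⊆ Z → closure A Y ⊆ closure A Z
closure-mono A {Y} {Z} Y⊆Z v e with Equivalence.to (∨-true {Y v}) e
... | inj₁ Yv = Equivalence.from (∨-true {Z v}) (inj₁ (Y⊆Z v Yv))
... | inj₂ oY = Equivalence.from (∨-true {Z v}) (inj₂ (out-mono {A′ = A} {A} (λ _ _ e → e) Y⊆Z v oY))

-- The
-- closure of a union is the union of closures, the closure of an
-- intersection lies in the intersection of closures; inclusion–exclusion
-- on both levels then leaves only the stated inequality.
beyond-submodular : ∀ {n} (A : Adj n) (Y Z : VSet n) →
  size (beyond A (Y ∪ Z)) + size (beyond A (Y ∩ Z)) ≤ size (beyond A Y) + size (beyond A Z)
beyond-submodular A Y Z = ℕP.+-cancelˡ-≤ (size U + size C) _ _ (begin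
  (size U + size C) + (size (beyond A U) + size (beyond A C))   ≡⟨ +-interchange (size U) (size C) _ _ ⟩
  (size U + size (beyond A U)) + (size C + size (beyond A C))   ≡⟨ sym (cong₂ _+_ (size-closure A U) (size-closure A C)) ⟩
  size (closure A U) + size (closure A C)                       ≤⟨ ℕP.+-mono-≤ (ℕP.≤-reflexive (size-cong closure-∪)) (size-mono closure-∩) ⟩
  size (closure A Y ∪ closure A Z) + size (closure A Y ∩ closure A Z) ≡⟨ size-∪-∩ (closure A Y) (closure A Z) ⟩
  size (closure A Y) + size (closure A Z)                       ≡⟨ cong₂ _+_ (size-closure A Y) (size-closure A Z) ⟩
  (size Y + size (beyond A Y)) + (size Z + size (beyond A Z))   ≡⟨ +-interchange (size Y) _ (size Z) _ ⟩
  (size Y + size Z) + (size (beyond A Y) + size (beyond A Z))   ≡⟨ cong (_+ (size (beyond A Y) + size (beyond A Z))) (sym (size-∪-∩ Y Z)) ⟩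
  (size U + size C) + (size (beyond A Y) + size (beyond A Z))   ∎)
  where
  open ℕP.≤-Reasoning
  U C : VSet _
  U = Y ∪ Z
  C = Y ∩ Z
  closure-∪ : closure A U ≐ closure A Y ∪ closure A Z
  closure-∪ v = trans (cong (U v ∨_) (out-∪ A Y Z v)) (∨-interchange (Y v) (Z v) (out A Y v) (out A Z v))
  closure-∩ : closure A C ⊆ closure A Y ∩ closure A Z
  closure-∩ v e = Equivalence.from ∧-true
    ( closure-mono A (λ w Cw → proj₁ (Equivalence.to ∧-true Cw)) v e
    , closure-mono A (λ w Cw → proj₂ (Equivalence.to (∧-true {Y w}) Cw)) v e )

out-single : ∀ {n} (A : Adj n) {Y : VSet n} {u : Fin n} → (∀ w → Y w ≡ true ⇔ w ≡ u) → out A Y ≐ A u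
out-single A {Y} {u} Y⇔u v = BoolP.⇔→≡ (mk⇔ to from)
  where
  to : out A Y v ≡ true → A u v ≡ true
  to e with Equivalence.to (out-true A Y v) e
  ... | w , Yw , Awv = subst (λ x → A x v ≡ true) (Equivalence.to (Y⇔u w) Yw) Awv
  from : A u v ≡ true → out A Y v ≡ true
  from Auv = Equivalence.from (out-true A Y v) (u , Equivalence.from (Y⇔u u) refl , Auv)

does-≟ : ∀ {n} (s v : Fin n) → does (s ≟ v) ≡ true ⇔ s ≡ v
does-≟ s v with s ≟ v
... | yes s≡v = mk⇔ (λ _ → s≡v) (λ _ → refl)
... | no  s≢v = mk⇔ (λ ()) (λ s≡v → ⊥-elim (s≢v s≡v))

walkFrom-zero : ∀ {n} (A : Adj n) (S : Subset n) → walkFrom A S 0 ≐ lookup S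
walkFrom-zero A S v = BoolP.⇔→≡ (mk⇔ to from)
  where
  to : walkFrom A S 0 v ≡ true → lookup S v ≡ true
  to e with Equivalence.to (any-true _) e
  ... | s , e′ with Equivalence.to ∧-true e′
  ...   | Ss , s≟v = subst (λ x → lookup S x ≡ true) (Equivalence.to (does-≟ s v) s≟v) Ss
  from : lookup S v ≡ true → walkFrom A S 0 v ≡ true
  from Sv = Equivalence.from (any-true _) (v , Equivalence.from ∧-true (Sv , Equivalence.from (does-≟ v v) refl))

walkFrom-suc : ∀ {n} (A : Adj n) (S : Subset n) k → walkFrom A S (suc k) ≐ out A (walkFrom A S k)
walkFrom-suc A S k v = BoolP.⇔→≡ (mk⇔ to from)
  where
  to : walkFrom A S (suc k) v ≡ true → out A (walkFrom A S k) v ≡ true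
  to e with Equivalence.to (any-true _) e
  ... | s , e′ with Equivalence.to ∧-true e′
  ...   | Ss , sv with Equivalence.to (out-true A (walk A k s) v) sv
  ...     | w , sw , Awv = Equivalence.from (out-true A _ v)
    (w , Equivalence.from (any-true _) (s , Equivalence.from ∧-true (Ss , sw)) , Awv)
  from : out A (walkFrom A S k) v ≡ true → walkFrom A S (suc k) v ≡ true
  from e with Equivalence.to (out-true A _ v) e
  ... | w , Sw , Awv with Equivalence.to (any-true _) Sw
  ...   | s , e′ with Equivalence.to ∧-true e′
  ...     | Ss , sw = Equivalence.from (any-true _)
    (s , Equivalence.from ∧-true (Ss , Equivalence.from (out-true A (walk A k s) v) (w , sw , Awv)))

walkFrom-one : ∀ {n} (A : Adj n) (S : Subset n) → walkFrom A S 1 ≐ out A (lookup S)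
walkFrom-one A S v = trans (walkFrom-suc A S 0 v) (out-cong A (walkFrom-zero A S) v)

N₁⁺-out : ∀ {n} (A : Adj n) (S : Subset n) → atDist A S 1 ≐ out A (lookup S)
N₁⁺-out A S v = trans (BoolP.∧-identityʳ (walkFrom A S 1 v)) (walkFrom-one A S v)

N₂⁺-beyond : ∀ {n} (A : Adj n) (S : Subset n) → atDist A S 2 ≐ beyond A (out A (lookup S))
N₂⁺-beyond A S v = cong₂ (λ x y → x ∧ not y)
  (trans (walkFrom-suc A S 1 v) (out-cong A (walkFrom-one A S) v))
  (trans (BoolP.∨-identityʳ (walkFrom A S 1 v)) (walkFrom-one A S v))

d₁⁺-size : ∀ {n} (A : Adj n) (S : Subset n) → d⁺ A 1 S ≡ size (out A (lookup S))
d₁⁺-size A S = trans (size-tabulate (atDist A S 1)) (size-cong (N₁⁺-out A S))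

d₂⁺-size : ∀ {n} (A : Adj n) (S : Subset n) → d⁺ A 2 S ≡ size (beyond A (out A (lookup S)))
d₂⁺-size A S = trans (size-tabulate (atDist A S 2)) (size-cong (N₂⁺-beyond A S))

out-⁅⁆ : ∀ {n} (A : Adj n) u → out A (lookup ⁅ u ⁆) ≐ A u
out-⁅⁆ A u = out-single A (λ w → mk⇔
  (λ e → Equivalence.to SubsetP.x∈⁅y⁆⇔x≡y (VecP.lookup⇒[]= w ⁅ u ⁆ e))
  (λ { refl → VecP.[]=⇒lookup (SubsetP.x∈⁅x⁆ u) }))

d₁⁺-single : ∀ {n} (A : Adj n) u → d⁺ A 1 ⁅ u ⁆ ≡ size (A u)
d₁⁺-single A u = trans (d₁⁺-size A ⁅ u ⁆) (size-cong (out-⁅⁆ A u))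

d₂⁺-single : ∀ {n} (A : Adj n) u → d⁺ A 2 ⁅ u ⁆ ≡ size (beyond A (A u))
d₂⁺-single A u = trans (d₂⁺-size A ⁅ u ⁆) (size-cong (beyond-cong A (out-⁅⁆ A u)))

-- The only part of orientedness the argument uses.
Loopless : ∀ {n} → Adj n → Set
Loopless A = ∀ v → A v v ≡ false

beyond-mono-edges : ∀ {n} {A′ A : Adj n} (Y : VSet n) → A′ ⊆ₑ A → beyond A′ Y ⊆ beyond A Y
beyond-mono-edges {A′ = A′} {A} Y A′⊆A v e =
  let o , ¬Y = Equivalence.to (∧-true {out A′ Y v}) e
  in Equivalence.from ∧-true (out-mono {Y = Y} A′⊆A (λ _ y → y) v o , ¬Y)

-- A with the out-neighbourhood of u replaced by T.  For T ⊆ A u this deletes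
-- the edges from u to A u ∖ T.
redirect : ∀ {n} → Adj n → Fin n → VSet n → Adj n
redirect A u T w v = if does (w ≟ u) then T v else A w v

redirect-at : ∀ {n} (A : Adj n) u T → redirect A u T u ≐ T
redirect-at A u T v with u ≟ u
... | yes _   = refl
... | no  u≢u = ⊥-elim (u≢u refl)

redirect-away : ∀ {n} (A : Adj n) {u w} T → ¬ w ≡ u → redirect A u T w ≐ A w
redirect-away A {u} {w} T w≢u v with w ≟ u
... | yes w≡u = ⊥-elim (w≢u w≡u)
... | no  _   = refl

redirect-⊆ₑ : ∀ {n} (A : Adj n) u {T} → T ⊆ A u → redirect A u T ⊆ₑ A
redirect-⊆ₑ A u {T} T⊆Au w v e with w ≟ u
... | yes refl = T⊆Au v e
... | no  _    = e

-- In a loopless digraph u ∉ A u, so redirecting u to T ⊆ A u leaves every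
-- edge out of T untouched.
out-redirect : ∀ {n} (A : Adj n) → Loopless A → ∀ u {T} → T ⊆ A u → out (redirect A u T) T ≐ out A T
out-redirect {n} A loopless u {T} T⊆Au v =
  cong or (ListP.map-cong edge-kept (allFin n))
  where
  edge-kept : ∀ w → (T w ∧ redirect A u T w v) ≡ (T w ∧ A w v)
  edge-kept w with T w in Tw
  ... | false = refl
  ... | true  = redirect-away A T (λ { refl → u∉Au Tw }) v
    where
    u∉Au : T u ≡ true → ⊥
    u∉Au Tu with () ← trans (sym (loopless u)) (T⊆Au u Tu)

redirect-d₁⁺-at : ∀ {n} (A : Adj n) u T → d⁺ (redirect A u T) 1 ⁅ u ⁆ ≡ size T
redirect-d₁⁺-at A u T = trans (d₁⁺-single (redirect A u T) u) (size-cong (redirect-at A u T))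

redirect-d₂⁺-at : ∀ {n} (A : Adj n) → Loopless A → ∀ u {T} → T ⊆ A u →
  d⁺ (redirect A u T) 2 ⁅ u ⁆ ≡ size (beyond A T)
redirect-d₂⁺-at A loopless u {T} T⊆Au = begin
  d⁺ A′ 2 ⁅ u ⁆           ≡⟨ d₂⁺-single A′ u ⟩
  size (beyond A′ (A′ u)) ≡⟨ size-cong (beyond-cong A′ (redirect-at A u T)) ⟩
  size (beyond A′ T)      ≡⟨ size-cong (λ v → cong (_∧ not (T v)) (out-redirect A loopless u T⊆Au v)) ⟩
  size (beyond A T)       ∎
  where
  open ≡-Reasoning
  A′ = redirect A u T

redirect-d₁⁺-away : ∀ {n} (A : Adj n) {u w} T → ¬ w ≡ u → d⁺ (redirect A u T) 1 ⁅ w ⁆ ≡ d⁺ A 1 ⁅ w ⁆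
redirect-d₁⁺-away A {u} {w} T w≢u = begin
  d⁺ (redirect A u T) 1 ⁅ w ⁆  ≡⟨ d₁⁺-single (redirect A u T) w ⟩
  size (redirect A u T w)      ≡⟨ size-cong (redirect-away A T w≢u) ⟩
  size (A w)                   ≡⟨ d₁⁺-single A w ⟨
  d⁺ A 1 ⁅ w ⁆                 ∎
  where open ≡-Reasoning

redirect-d₂⁺-away : ∀ {n} (A : Adj n) {u w T} → T ⊆ A u → ¬ w ≡ u →
  d⁺ (redirect A u T) 2 ⁅ w ⁆ ≤ d⁺ A 2 ⁅ w ⁆
redirect-d₂⁺-away A {u} {w} {T} T⊆Au w≢u = begin
  d⁺ A′ 2 ⁅ w ⁆           ≡⟨ d₂⁺-single A′ w ⟩
  size (beyond A′ (A′ w)) ≡⟨ size-cong (beyond-cong A′ (redirect-away A T w≢u)) ⟩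
  size (beyond A′ (A w))  ≤⟨ size-mono (beyond-mono-edges (A w) (redirect-⊆ₑ A u T⊆Au)) ⟩
  size (beyond A (A w))   ≡⟨ d₂⁺-single A w ⟨
  d⁺ A 2 ⁅ w ⁆            ∎
  where
  open ℕP.≤-Reasoning
  A′ = redirect A u T

redirect-counterexample : ∀ {n} (λ′ : ℝ) (A : Adj n) → Loopless A → Counterexample λ′ A →
  ∀ u {T} → T ⊆ A u → size (beyond A T) <ℝ λ′ · size T → Counterexample λ′ (redirect A u T)
redirect-counterexample λ′ A loopless ce u {T} T⊆Au bound w = by-cases (w ≟ u)
  where
  by-cases : Dec (w ≡ u) → d⁺ (redirect A u T) 2 ⁅ w ⁆ <ℝ λ′ · d⁺ (redirect A u T) 1 ⁅ w ⁆
  by-cases (yes refl) = subst₂ (λ a b → a <ℝ λ′ · b)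
    (sym (redirect-d₂⁺-at A loopless u T⊆Au)) (sym (redirect-d₁⁺-at A u T)) bound
  by-cases (no w≢u) = <ℝ-antitoneˡ λ′ {b = d⁺ (redirect A u T) 1 ⁅ w ⁆} (redirect-d₂⁺-away A T⊆Au w≢u)
    (subst (λ b → d⁺ A 2 ⁅ w ⁆ <ℝ λ′ · b) (sym (redirect-d₁⁺-away A T w≢u)) (ce w))

-- Edge-minimality: a proper subset T of an out-neighbourhood A u (missing
-- some v₀ ∈ A u) cannot satisfy  |beyond A T| < λ|T|, since redirecting u
-- to T deletes the edge u v₀ and leaves a λ-counterexample.
proper-part-not-below : ∀ {n} (λ′ : ℝ) (A : Adj n) → Loopless A → EdgeMinimal λ′ A →
  ∀ u {T} v₀ → T ⊆ A u → A u v₀ ≡ true → T v₀ ≡ false →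
  ¬ (size (beyond A T) <ℝ λ′ · size T)
proper-part-not-below λ′ A loopless (ce , minimal) u {T} v₀ T⊆Au Auv₀ Tv₀ bound =
  minimal (redirect A u T)
    (redirect-⊆ₑ A u T⊆Au , u , v₀ , Auv₀ , trans (redirect-at A u T v₀) Tv₀)
    (redirect-counterexample λ′ A loopless ce u T⊆Au bound)

BelowRatio : ∀ {n} → ℝ → Adj n → VSet n → Set
BelowRatio λ′ A Y = (∃ λ v → Y v ≡ true) → size (beyond A Y) <ℝ λ′ · size Y

BelowRatio-cong : ∀ {n} (λ′ : ℝ) (A : Adj n) {Y Z : VSet n} → Y ≐ Z → BelowRatio λ′ A Y → BelowRatio λ′ A Z
BelowRatio-cong λ′ A Y≐Z bY (v , Zv) = subst₂ (λ a b → a <ℝ λ′ · b)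
  (size-cong (beyond-cong A Y≐Z)) (size-cong Y≐Z) (bY (v , trans (Y≐Z v) Zv))

row-below : ∀ {n} (λ′ : ℝ) (A : Adj n) → Counterexample λ′ A → ∀ x → BelowRatio λ′ A (A x)
row-below λ′ A ce x _ = subst₂ (λ a b → a <ℝ λ′ · b) (d₂⁺-single A x) (d₁⁺-single A x) (ce x)

∪-emptyʳ : ∀ {n} (Y Z : VSet n) → ¬ (∃ λ v → Z v ≡ true) → Y ∪ Z ≐ Y
∪-emptyʳ Y Z Z-empty v =
  trans (cong (Y v ∨_) (BoolP.¬-not (λ Zv → Z-empty (v , Zv)))) (BoolP.∨-identityʳ (Y v))

∪-absorbˡ : ∀ {n} (Y Z : VSet n) → ¬ (∃ λ v → (Y ∖ Z) v ≡ true) → Y ∪ Z ≐ Z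
∪-absorbˡ Y Z Y∖Z-empty v with Z v in Zv
... | true  = BoolP.∨-zeroʳ (Y v)
... | false = trans (BoolP.∨-identityʳ (Y v)) (BoolP.¬-not Yv≢true)
  where
  Yv≢true : ¬ Y v ≡ true
  Yv≢true Yv = Y∖Z-empty (v , Equivalence.from ∧-true (Yv , cong not Zv))

-- Either one part is
-- empty or absorbed, or C = A x ∩ Z is a proper part of A x; then
-- submodularity and inclusion–exclusion, with |beyond C| ≥ λ|C| from
-- edge-minimality, carry the strict bounds for A x and Z over to A x ∪ Z.
union-step : ∀ {n} (λ′ : ℝ) (A : Adj n) → Loopless A → EdgeMinimal λ′ A →
  ∀ x (Z : VSet n) → BelowRatio λ′ A Z → BelowRatio λ′ A (A x ∪ Z)
union-step {n} λ′ A loopless em@(ce , _) x Z bZ =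
  by-cases (FinP.any? (λ v → Z v Bool.≟ true)) (FinP.any? (λ v → (A x ∖ Z) v Bool.≟ true))
  where
  C : VSet n
  C = A x ∩ Z
  by-cases : Dec (∃ λ v → Z v ≡ true) → Dec (∃ λ v → (A x ∖ Z) v ≡ true) → BelowRatio λ′ A (A x ∪ Z)
  by-cases (no Z-empty) _ =
    BelowRatio-cong λ′ A (λ v → sym (∪-emptyʳ (A x) Z Z-empty v)) (row-below λ′ A ce x)
  by-cases (yes _) (no Ax⊆Z) =
    BelowRatio-cong λ′ A (λ v → sym (∪-absorbˡ (A x) Z Ax⊆Z v)) bZ
  by-cases (yes Z-nonempty) (yes (v₀ , v₀∈Ax∖Z)) _ =
    <ℝ-exchange λ′ (size (beyond A (A x ∪ Z))) (size (A x ∪ Z)) (size (beyond A C)) (size C)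
      (size (beyond A (A x))) (size (A x)) (size (beyond A Z)) (size Z)
      (beyond-submodular A (A x) Z) (size-∪-∩ (A x) Z)
      (row-below λ′ A ce x (v₀ , Axv₀)) (bZ Z-nonempty) C-not-below
    where
    Axv₀ : A x v₀ ≡ true
    Axv₀ = proj₁ (Equivalence.to ∧-true v₀∈Ax∖Z)
    Cv₀≡false : C v₀ ≡ false
    Cv₀≡false = trans (cong (A x v₀ ∧_) (BoolP.not-injective (proj₂ (Equivalence.to ∧-true v₀∈Ax∖Z))))
                      (BoolP.∧-zeroʳ (A x v₀))
    C-not-below : ¬ (size (beyond A C) <ℝ λ′ · size C)
    C-not-below = proper-part-not-below λ′ A loopless em x {C} v₀
      (λ v e → proj₁ (Equivalence.to (∧-true {A x v}) e)) Axv₀ Cv₀≡false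

-- The union of the rows A s over those s ∈ xs that lie in S; for xs = allFin n
-- this is definitionally  out A (lookup S) = N₁⁺(S).
rows : ∀ {n} → Adj n → Subset n → List (Fin n) → VSet n
rows A S xs v = any (λ s → lookup S s ∧ A s v) xs

rows-below : ∀ {n} (λ′ : ℝ) (A : Adj n) → Loopless A → EdgeMinimal λ′ A →
  ∀ S xs → BelowRatio λ′ A (rows A S xs)
rows-below λ′ A loopless em S []       (_ , ())
rows-below λ′ A loopless em S (x ∷ xs) = by-membership (lookup S x)
  where
  -- rows A S (x ∷ xs) is this set with b = lookup S x.
  by-membership : ∀ b → BelowRatio λ′ A (λ v → (b ∧ A x v) ∨ rows A S xs v)
  by-membership true  = union-step λ′ A loopless em x (rows A S xs) (rows-below λ′ A loopless em S xs)
  by-membership false = rows-below λ′ A loopless em S xs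

lemma1 : (λ' : ℝ) (n : ℕ) (A : Adj n) → Oriented A → EdgeMinimal λ' A →
    (S : Subset n) → Nonempty (N⁺ A 1 S) →
    d⁺ A 2 S <ℝ λ' · d⁺ A 1 S
lemma1 λ' n A oriented em S (x , x∈N₁) =
  subst₂ (λ a b → a <ℝ λ' · b) (sym (d₂⁺-size A S)) (sym (d₁⁺-size A S))
    (rows-below λ' A (Oriented.loopless oriented) em S (allFin n) (x , x∈out))
  where
  x∈out : out A (lookup S) x ≡ true
  x∈out = trans (sym (N₁⁺-out A S x))
    (trans (sym (VecP.lookup∘tabulate (atDist A S 1) x)) (VecP.[]=⇒lookup x∈N₁))
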